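{- Let $p$ and $q$ be distinct primes and $n$ a positive integer. Then $\lambda(\Gamma_{\mathbb{Z}_{pq^n}})=2q^{n-1}(pq-p+1)-2$ if $p<q$, and $\lambda(\Gamma_{\mathbb{Z}_{pq^n}})=2q^{n}(p-1)$ if $q<p$.
   Context: $\mathbb{Z}_m$ denotes the cyclic group of order $m$. The (undirected) power graph $\Gamma_G$ of a finite group $G$ has vertex set $G$, two distinct elements being adjacent if one is a power of the other. An $L(2,1)$-labeling of a graph $\Gamma$ is a function $f:V(\Gamma)\to\mathbb{Z}_{\ge 0}$ such that $|f(u)-f(v)|\ge 2$ for adjacent $u,v$ and $|f(u)-f(v)|\ge 1$ for $u,v$ at distance two; its span is $\max f-\min f$, and $\lambda(\Gamma)$ is the minimum span over all $L(2,1)$-labelings of $\Gamma$. -}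

module Defs where

open import Data.Nat using (ℕ; _+_; _*_; _∸_; _≤_)
open import Data.Fin using (Fin; toℕ)
open import Data.Product using (∃; ∃-syntax; _×_)
open import Data.Sum using (_⊎_)
open import Relation.Binary.PropositionalEquality using (_≡_; _≢_)
open import Relation.Nullary using (¬_)

-- The cyclic group Z_m, modelled additively on Fin m (residues 0..m-1).
-- In additive notation the "powers" x^k of x are the multiples k·x (mod m), k ∈ ℕ.
IsPowerOf : (m : ℕ) → Fin m → Fin m → Set
IsPowerOf m y x = ∃[ k ] ∃[ t ] (k * toℕ x ≡ toℕ y + t * m)

PowAdj : (m : ℕ) → Fin m → Fin m → Set
PowAdj m u v = u ≢ v × (IsPowerOf m u v ⊎ IsPowerOf m v u)

Graph : ℕ → Set₁
Graph m = Fin m → Fin m → Set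

Dist2 : ∀ {m} → Graph m → Fin m → Fin m → Set
Dist2 {m} G u v = u ≢ v × ¬ G u v × ∃[ w ] (G u w × G w v)

dist : ℕ → ℕ → ℕ
dist a b = (a ∸ b) + (b ∸ a)

IsL21 : ∀ {m} → Graph m → (Fin m → ℕ) → Set
IsL21 {m} G f =
  (∀ u v → G u v → 2 ≤ dist (f u) (f v)) ×
  (∀ u v → Dist2 G u v → 1 ≤ dist (f u) (f v))

-- span f ≤ s  (span = max f − min f = max over u,v of f u ∸ f v)
SpanAtMost : ∀ {m} → (Fin m → ℕ) → ℕ → Set
SpanAtMost {m} f s = ∀ u v → f u ∸ f v ≤ s

SpanAtLeast : ∀ {m} → (Fin m → ℕ) → ℕ → Set
SpanAtLeast {m} f s = ∃[ u ] ∃[ v ] (s ≤ f u ∸ f v)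

LambdaIs : ∀ {m} → Graph m → ℕ → Set
LambdaIs {m} G L =
  (∃[ f ] (IsL21 G f × SpanAtMost f L)) ×
  (∀ f → IsL21 G f → SpanAtLeast f L)

-- Write M = p·q^n. In Γ = Γ_{Z_M}, w is a power of u iff gcd(u, M) ∣ w, and the gcds of the
-- elements outside O form a chain under divisibility, where O = {q ∣ x, p ∤ x} if p < q and
-- O = {p ∣ x, x ≠ 0} if q < p. So the complement of O is a clique of size T = M − |O|, which
-- forces span ≥ 2T − 2. Conversely, give O the odd labels 1, 3, … and the complement the even
-- labels 0, 2, …, 2T − 2, starting with a class E larger than O: E = {p ∣ x, q ∤ x} if p < q
-- and E = {q ∣ x, p ∤ x} if q < p. Labels differing by one then always go to some o ∈ O and
-- e ∈ E, which must be non-adjacent. For p < q every such pair is. For q < p, listing O and E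
-- by decreasing q-adic valuation ν, counting multiples of p·q^ν(o) and q^(ν(o)+1) shows that
-- labels this close force ν(o) < ν(e), which makes o and e non-adjacent.

module Submission where

open import Defs
open import Data.Nat.Base
open import Data.Nat.Properties
open import Algebra.Properties.CommutativeSemigroup *-commutativeSemigroup using (x∙yz≈y∙xz)
open import Data.Nat.Coprimality using (Coprime; coprime-divisor)
import Data.Nat.Coprimality as Coprime
open import Data.Nat.Divisibility
open import Data.Nat.DivMod using (_%_; _/_; m≡m%n+[m/n]*n; [m+kn]%n≡m%n; %-distribˡ-*; m<n⇒m%n≡m)
open import Data.Nat.GCD using (gcd; gcd-GCD; gcd[m,n]∣m; gcd[m,n]∣n; module Bézout)
open import Data.Nat.Primality using (Prime; prime⇒irreducible; prime⇒nonZero; prime⇒nonTrivial; euclidsLemma)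
open import Data.Nat.Tactic.RingSolver using (solve-∀)
open import Data.Fin.Base using (Fin; toℕ; fromℕ<; punchOut)
open import Data.Fin.Properties using (¬Fin0; punchOut-injective; toℕ<n; toℕ-injective; toℕ-fromℕ<)
open import Data.List.Base using (allFin)
open import Data.List.Extrema.Nat using (argmax; argmin; f[xs]≤f[argmax]; f[argmin]≤f[xs])
open import Data.List.Membership.Propositional.Properties using (∈-allFin)
import Data.List.Relation.Unary.All as All
open import Data.Product.Base using (_×_; _,_; proj₁; proj₂; ∃-syntax; swap)
open import Data.Sum.Base using (_⊎_; inj₁; inj₂; [_,_]′)
open import Function.Base using (_∘_; const; flip; id)
open import Level using (0ℓ)
open import Relation.Binary.Definitions using (tri<; tri≈; tri>)
open import Relation.Binary.PropositionalEquality
open import Relation.Nullary using (¬_; yes; no)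
open import Relation.Nullary.Negation using (contradiction)
open import Relation.Unary using (Pred; Decidable; ∁; _∩_)
open import Relation.Unary.Properties using (∁?; _∩?_)

private variable
  P Q : Pred ℕ 0ℓ
  k : ℕ

count : Decidable P → ℕ → ℕ
count P? zero = zero
count P? (suc k) with P? k
... | yes _ = suc (count P? k)
... | no  _ = count P? k

count-mono : (P? : Decidable P) (Q? : Decidable Q) (k : ℕ) →
  (∀ {x} → x < k → P x → Q x) → count P? k ≤ count Q? k
count-mono P? Q? zero P⊆Q = z≤n
count-mono P? Q? (suc k) P⊆Q with P? k | Q? k
... | yes Pk | no ¬Qk = contradiction (P⊆Q ≤-refl Pk) ¬Qk
... | yes _  | yes _  = s≤s (count-mono P? Q? k (P⊆Q ∘ m<n⇒m<1+n))
... | no _   | yes _  = m≤n⇒m≤1+n (count-mono P? Q? k (P⊆Q ∘ m<n⇒m<1+n))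
... | no _   | no _   = count-mono P? Q? k (P⊆Q ∘ m<n⇒m<1+n)

count-mono-< : (P? : Decidable P) (Q? : Decidable Q) (k : ℕ) →
  (∀ {x} → x < k → P x → Q x) → ∀ {z} → z < k → Q z → ¬ P z →
  count P? k < count Q? k
count-mono-< P? Q? (suc k) P⊆Q z<1+k Qz ¬Pz with P? k | Q? k | m<1+n⇒m<n∨m≡n z<1+k
... | yes Pk | no ¬Qk | _         = contradiction (P⊆Q ≤-refl Pk) ¬Qk
... | yes _  | yes _  | inj₁ z<k  = s≤s (count-mono-< P? Q? k (P⊆Q ∘ m<n⇒m<1+n) z<k Qz ¬Pz)
... | yes Pk | yes _  | inj₂ refl = contradiction Pk ¬Pz
... | no _   | yes _  | _         = s≤s (count-mono P? Q? k (P⊆Q ∘ m<n⇒m<1+n))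
... | no _   | no _   | inj₁ z<k  = count-mono-< P? Q? k (P⊆Q ∘ m<n⇒m<1+n) z<k Qz ¬Pz
... | no _   | no ¬Qk | inj₂ refl = contradiction Qz ¬Qk

count-cong : (P? : Decidable P) (Q? : Decidable Q) (k : ℕ) →
  (∀ {x} → x < k → P x → Q x) → (∀ {x} → x < k → Q x → P x) →
  count P? k ≡ count Q? k
count-cong P? Q? k P⊆Q Q⊆P = ≤-antisym (count-mono P? Q? k P⊆Q) (count-mono Q? P? k Q⊆P)

count-∩-∁ : (P? : Decidable P) (Q? : Decidable Q) → ∀ k →
  count P? k ≡ count (P? ∩? Q?) k + count (P? ∩? ∁? Q?) k
count-∩-∁ P? Q? zero = refl
count-∩-∁ P? Q? (suc k) with P? k | Q? k
... | yes _ | yes _ = cong suc (count-∩-∁ P? Q? k)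
... | yes _ | no _  = trans (cong suc (count-∩-∁ P? Q? k)) (sym (+-suc _ _))
... | no _  | _     = count-∩-∁ P? Q? k

count+count-∁ : (P? : Decidable P) → ∀ k → count P? k + count (∁? P?) k ≡ k
count+count-∁ P? zero = refl
count+count-∁ P? (suc k) with P? k
... | yes _ = cong suc (count+count-∁ P? k)
... | no _  = trans (+-suc _ _) (cong suc (count+count-∁ P? k))

count-≡0 : ∀ k → count (_≟ 0) (suc k) ≡ 1
count-≡0 zero = refl
count-≡0 (suc k) = count-≡0 k

count-multiples : ∀ d c .{{_ : NonZero d}} → count (d ∣?_) (c * d) ≡ c
count-multiples d zero = refl
count-multiples d@(suc d-1) (suc c) = begin
  count (d ∣?_) (suc c * d)      ≡⟨ cong (count (d ∣?_)) (+-comm d (c * d)) ⟩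
  count (d ∣?_) (c * d + suc d-1) ≡⟨ next-block d-1 ≤-refl ⟩
  suc c                          ∎
  where
  open ≡-Reasoning
  next-block : ∀ j → j < d → count (d ∣?_) (c * d + suc j) ≡ suc c
  next-block zero _ rewrite +-comm (c * d) 1 with d ∣? c * d
  ... | yes _ = cong suc (count-multiples d c)
  ... | no ∤ = contradiction (n∣m*n c) ∤
  next-block (suc j) 1+j<d rewrite +-suc (c * d) (suc j) with d ∣? c * d + suc j
  ... | yes d∣ = contradiction (∣⇒≤ (∣m+n∣m⇒∣n d∣ (n∣m*n c))) (<⇒≱ 1+j<d)
  ... | no _  = next-block j (<⇒≤ 1+j<d)

count≤-injection : (P? : Decidable P) {m b : ℕ} (g : ∀ {x} → x < m → P x → Fin b) →
  (∀ {x y} (x<m : x < m) (y<m : y < m) (Px : P x) (Py : P y) → g x<m Px ≡ g y<m Py → x ≡ y) →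
  count P? m ≤ b
count≤-injection P? {zero} g g-inj = z≤n
count≤-injection {P = P} P? {suc m} {b} g g-inj with P? m
... | no _ = count≤-injection P? (g ∘ m<n⇒m<1+n)
               (λ x<m y<m → g-inj (m<n⇒m<1+n x<m) (m<n⇒m<1+n y<m))
... | yes Pm = remove b g g-inj
  where
  remove : ∀ b (g : ∀ {x} → x < suc m → P x → Fin b) →
    (∀ {x y} (x<1+m : x < suc m) (y<1+m : y < suc m) (Px : P x) (Py : P y) → g x<1+m Px ≡ g y<1+m Py → x ≡ y) →
    suc (count P? m) ≤ b
  remove zero g _ = contradiction (g ≤-refl Pm) ¬Fin0
  remove (suc b) g g-inj = s≤s (count≤-injection P? (λ x<m Px → punchOut (avoids x<m Px))
      (λ x<m y<m Px Py → g-inj _ _ Px Py ∘ punchOut-injective (avoids x<m Px) (avoids y<m Py)))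
    where
    avoids : ∀ {x} (x<m : x < m) (Px : P x) → g ≤-refl Pm ≢ g (m<n⇒m<1+n x<m) Px
    avoids x<m Px eq = <⇒≢ x<m (sym (g-inj _ _ Pm Px eq))

record Ranking (S : Pred ℕ 0ℓ) (m size : ℕ) : Set where
  field
    rank           : ℕ → ℕ
    rank-injective : ∀ {x y} → x < m → y < m → S x → S y → rank x ≡ rank y → x ≡ y
    rank<size      : ∀ {x} → x < m → S x → rank x < size

module _ {S : Pred ℕ 0ℓ} (S? : Decidable S) (κ : ℕ → ℕ) (m : ℕ) where

  rankBy : ℕ → ℕ
  rankBy x = count (S? ∩? λ y → κ y <? κ x) m

  rankBy-< : ∀ {x y} → x < m → S x → κ x < κ y → rankBy x < rankBy y
  rankBy-< x<m Sx κx<κy =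
    count-mono-< _ _ m (λ _ (Sz , κz<κx) → Sz , <-trans κz<κx κx<κy) x<m (Sx , κx<κy) (<-irrefl refl ∘ proj₂)

  rankingBy : (∀ {x y} → x < m → y < m → κ x ≡ κ y → x ≡ y) → Ranking S m (count S? m)
  rankingBy κ-inj = record
    { rank           = rankBy
    ; rank-injective = rank-injective
    ; rank<size      = λ x<m Sx → count-mono-< _ S? m (λ _ → proj₁) x<m Sx (<-irrefl refl ∘ proj₂)
    }
    where
    rank-injective : ∀ {x y} → x < m → y < m → S x → S y → rankBy x ≡ rankBy y → x ≡ y
    rank-injective {x} {y} x<m y<m Sx Sy eq with <-cmp (κ x) (κ y)
    ... | tri< κx<κy _ _ = contradiction eq (<⇒≢ (rankBy-< x<m Sx κx<κy))
    ... | tri≈ _ κx≡κy _ = κ-inj x<m y<m κx≡κy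
    ... | tri> _ _ κy<κx = contradiction (sym eq) (<⇒≢ (rankBy-< y<m Sy κy<κx))

dist-cases : ∀ a b → a ≡ b ⊎ suc a ≡ b ⊎ suc b ≡ a ⊎ 2 ≤ dist a b
dist-cases zero          zero          = inj₁ refl
dist-cases zero          (suc zero)    = inj₂ (inj₁ refl)
dist-cases zero          (suc (suc b)) = inj₂ (inj₂ (inj₂ (s≤s (s≤s z≤n))))
dist-cases (suc zero)    zero          = inj₂ (inj₂ (inj₁ refl))
dist-cases (suc (suc a)) zero          = inj₂ (inj₂ (inj₂ (s≤s (s≤s z≤n))))
dist-cases (suc a)       (suc b) with dist-cases a b
... | inj₁ a≡b                 = inj₁ (cong suc a≡b)
... | inj₂ (inj₁ 1+a≡b)        = inj₂ (inj₁ (cong suc 1+a≡b))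
... | inj₂ (inj₂ (inj₁ 1+b≡a)) = inj₂ (inj₂ (inj₁ (cong suc 1+b≡a)))
... | inj₂ (inj₂ (inj₂ 2≤d))   = inj₂ (inj₂ (inj₂ 2≤d))

dist≡0⇒≡ : ∀ {a b} → dist a b ≡ 0 → a ≡ b
dist≡0⇒≡ {a} {b} d≡0 =
  ≤-antisym (m∸n≡0⇒m≤n (m+n≡0⇒m≡0 (a ∸ b) d≡0)) (m∸n≡0⇒m≤n (m+n≡0⇒n≡0 (a ∸ b) d≡0))

≢⇒1≤dist : ∀ {a b} → a ≢ b → 1 ≤ dist a b
≢⇒1≤dist a≢b = n≢0⇒n>0 (a≢b ∘ dist≡0⇒≡)

2≤dist⇒ : ∀ a b → 2 ≤ dist a b → 2 + a ≤ b ⊎ 2 + b ≤ a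
2≤dist⇒ zero          zero          ()
2≤dist⇒ zero          (suc zero)    (s≤s ())
2≤dist⇒ (suc zero)    zero          (s≤s ())
2≤dist⇒ zero          (suc (suc b)) _ = inj₁ (s≤s (s≤s z≤n))
2≤dist⇒ (suc (suc a)) zero          _ = inj₂ (s≤s (s≤s z≤n))
2≤dist⇒ (suc a)       (suc b)       2≤d with 2≤dist⇒ a b 2≤d
... | inj₁ 2+a≤b = inj₁ (s≤s 2+a≤b)
... | inj₂ 2+b≤a = inj₂ (s≤s 2+b≤a)

data Slot : Set where
  odd  : ℕ → Slot
  even : ℕ → Slot

odd-injective : ∀ {a b} → odd a ≡ odd b → a ≡ b
odd-injective refl = refl

even-injective : ∀ {a b} → even a ≡ even b → a ≡ b
even-injective refl = refl

⟦_⟧ : Slot → ℕ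
⟦ odd k ⟧  = suc (2 * k)
⟦ even k ⟧ = 2 * k

⟦⟧-injective : ∀ {s t} → ⟦ s ⟧ ≡ ⟦ t ⟧ → s ≡ t
⟦⟧-injective {odd a}  {odd b}  eq = cong odd (*-cancelˡ-≡ a b 2 (suc-injective eq))
⟦⟧-injective {odd a}  {even b} eq = contradiction (sym eq) (even≢odd b a)
⟦⟧-injective {even a} {odd b}  eq = contradiction eq (even≢odd a b)
⟦⟧-injective {even a} {even b} eq = cong even (*-cancelˡ-≡ a b 2 eq)

⟦⟧-consecutive : ∀ s t → suc ⟦ s ⟧ ≡ ⟦ t ⟧ →
  (∃[ k ] s ≡ even k × t ≡ odd k) ⊎ (∃[ k ] s ≡ odd k × t ≡ even (suc k))
⟦⟧-consecutive (odd a)  (odd b)  eq = contradiction (trans (*-suc 2 a) eq) (even≢odd (suc a) b)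
⟦⟧-consecutive (odd a)  (even b) eq = inj₂ (a , refl , cong even (*-cancelˡ-≡ b (suc a) 2 (trans (sym eq) (sym (*-suc 2 a)))))
⟦⟧-consecutive (even a) (odd b)  eq = inj₁ (a , refl , cong odd (sym (*-cancelˡ-≡ a b 2 (suc-injective eq))))
⟦⟧-consecutive (even a) (even b) eq = contradiction (sym eq) (even≢odd b a)

2*<⇒≤2*∸2 : ∀ {k n} → k < n → 2 * k ≤ 2 * n ∸ 2
2*<⇒≤2*∸2 {k} k<n = m+n≤o⇒m≤o∸n (2 * k)
  (≤-trans (≤-reflexive (trans (+-comm (2 * k) 2) (sym (*-suc 2 k)))) (*-monoʳ-≤ 2 k<n))

module Layered {m} (G : Graph m) (G-irreflexive : ∀ {u v} → G u v → u ≢ v)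
  {O E : Pred ℕ 0ℓ} (O? : Decidable O) (E? : Decidable E)
  {nO nE nR : ℕ} (rO : Ranking O m nO) (rE : Ranking E m nE) (rR : Ranking (∁ O ∩ ∁ E) m nR)
  (nO<nE : nO < nE)
  (separated : ∀ u v → O (toℕ u) → E (toℕ v) →
    Ranking.rank rE (toℕ v) ≤ suc (Ranking.rank rO (toℕ u)) → ¬ G u v × ¬ G v u)
  where

  open Ranking

  slot : ℕ → Slot
  slot x with O? x | E? x
  ... | yes _ | _     = odd (rank rO x)
  ... | no _  | yes _ = even (rank rE x)
  ... | no _  | no _  = even (nE + rank rR x)

  slot-odd : ∀ {x k} → slot x ≡ odd k → O x × rank rO x ≡ k
  slot-odd {x} eq with O? x | E? x | eq
  ... | yes Ox | _     | refl = Ox , refl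
  ... | no _   | yes _ | ()
  ... | no _   | no _  | ()

  private
    slot-below-rest : ∀ {j r} → j < nE → j ≢ nE + r
    slot-below-rest {r = r} j<nE refl = <⇒≱ j<nE (m≤m+n nE r)

  slot-even : ∀ {x j} → slot x ≡ even j → j < nE → E x × rank rE x ≡ j
  slot-even {x} eq j<nE with O? x | E? x | eq
  ... | yes _ | _      | ()
  ... | no _  | yes Ex | refl = Ex , refl
  ... | no _  | no _   | refl = contradiction refl (slot-below-rest j<nE)

  slot-injective : ∀ {x y} → x < m → y < m → slot x ≡ slot y → x ≡ y
  slot-injective {x} {y} x<m y<m eq with O? x | E? x | O? y | E? y | eq
  ... | yes Ox   | _      | yes Oy   | _      | eq′ = rank-injective rO x<m y<m Ox Oy (odd-injective eq′)
  ... | yes _    | _      | no _     | yes _  | ()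
  ... | yes _    | _      | no _     | no _   | ()
  ... | no _     | yes _  | yes _    | _      | ()
  ... | no _     | no _   | yes _    | _      | ()
  ... | no _     | yes Ex | no _     | yes Ey | eq′ = rank-injective rE x<m y<m Ex Ey (even-injective eq′)
  ... | no _     | yes Ex | no _     | no _   | eq′ = contradiction (even-injective eq′) (slot-below-rest (rank<size rE x<m Ex))
  ... | no _     | no _   | no _     | yes Ey | eq′ = contradiction (sym (even-injective eq′)) (slot-below-rest (rank<size rE y<m Ey))
  ... | no ¬Ox   | no ¬Ex | no ¬Oy   | no ¬Ey | eq′ =
    rank-injective rR x<m y<m (¬Ox , ¬Ex) (¬Oy , ¬Ey) (+-cancelˡ-≡ nE _ _ (even-injective eq′))

  slot-bound : ∀ {x} → x < m → ⟦ slot x ⟧ ≤ 2 * (nE + nR) ∸ 2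
  slot-bound {x} x<m with O? x | E? x
  ... | yes Ox | _ = ≤-trans (≤-trans (n≤1+n _) (≤-reflexive (sym (*-suc 2 _))))
    (2*<⇒≤2*∸2 (<-≤-trans (≤-<-trans (rank<size rO x<m Ox) nO<nE) (m≤m+n nE nR)))
  ... | no _ | yes Ex = 2*<⇒≤2*∸2 (<-≤-trans (rank<size rE x<m Ex) (m≤m+n nE nR))
  ... | no ¬Ox | no ¬Ex = 2*<⇒≤2*∸2 (+-monoʳ-< nE (rank<size rR x<m (¬Ox , ¬Ex)))

  labeling : Fin m → ℕ
  labeling v = ⟦ slot (toℕ v) ⟧

  consecutive-nonadjacent : ∀ u v → suc (labeling u) ≡ labeling v → ¬ G u v × ¬ G v u
  consecutive-nonadjacent u v eq with ⟦⟧-consecutive (slot (toℕ u)) (slot (toℕ v)) eq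
  ... | inj₁ (k , su , sv) with slot-odd sv
  ...   | Ov , refl with slot-even su (<-trans (rank<size rO (toℕ<n v) Ov) nO<nE)
  ...     | Eu , rEu≡k = swap (separated v u Ov Eu (≤-trans (≤-reflexive rEu≡k) (n≤1+n _)))
  consecutive-nonadjacent u v eq | inj₂ (k , su , sv) with slot-odd su
  ... | Ou , refl with slot-even sv (≤-<-trans (rank<size rO (toℕ<n u) Ou) nO<nE)
  ...   | Ev , rEv≡1+k = separated u v Ou Ev (≤-reflexive rEv≡1+k)

  labeling-injective : ∀ {u v} → u ≢ v → labeling u ≢ labeling v
  labeling-injective {u} {v} u≢v eq =
    u≢v (toℕ-injective (slot-injective (toℕ<n u) (toℕ<n v) (⟦⟧-injective eq)))

  labeling-isL21 : IsL21 G labeling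
  labeling-isL21 = adjacent-apart , λ _ _ (u≢v , _) → ≢⇒1≤dist (labeling-injective u≢v)
    where
    adjacent-apart : ∀ u v → G u v → 2 ≤ dist (labeling u) (labeling v)
    adjacent-apart u v Guv with dist-cases (labeling u) (labeling v)
    ... | inj₁ eq                = contradiction eq (labeling-injective (G-irreflexive Guv))
    ... | inj₂ (inj₁ eq)         = contradiction Guv (proj₁ (consecutive-nonadjacent u v eq))
    ... | inj₂ (inj₂ (inj₁ eq))  = contradiction Guv (proj₂ (consecutive-nonadjacent v u eq))
    ... | inj₂ (inj₂ (inj₂ 2≤d)) = 2≤d

  labeling-span : SpanAtMost labeling (2 * (nE + nR) ∸ 2)
  labeling-span u v = ≤-trans (m∸n≤m (labeling u) (labeling v)) (slot-bound (toℕ<n u))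

2*⌊n/2⌋≤n : ∀ n → 2 * ⌊ n /2⌋ ≤ n
2*⌊n/2⌋≤n n = begin
  2 * ⌊ n /2⌋             ≡⟨ cong (⌊ n /2⌋ +_) (+-identityʳ _) ⟩
  ⌊ n /2⌋ + ⌊ n /2⌋       ≤⟨ +-monoʳ-≤ ⌊ n /2⌋ (⌊n/2⌋≤⌈n/2⌉ n) ⟩
  ⌊ n /2⌋ + ⌈ n /2⌉       ≡⟨ ⌊n/2⌋+⌈n/2⌉≡n n ⟩
  n                       ∎
  where open ≤-Reasoning

-- Clique labels are pairwise at least 2 apart, so halving them (after subtracting the least
-- label) is injective on the clique.
clique-span : ∀ {m} (G : Graph m) {K : Pred ℕ 0ℓ} (K? : Decidable K) → 0 < m →
  (∀ u v → u ≢ v → K (toℕ u) → K (toℕ v) → G u v) →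
  ∀ f → IsL21 G f → SpanAtLeast f (2 * count K? m ∸ 2)
clique-span {m} G {K} K? 0<m K-clique f (apart , _) = vmax , vmin , 2c∸2≤span
  where
  v₀ vmax vmin : Fin m
  v₀   = fromℕ< 0<m
  vmax = argmax f v₀ (allFin m)
  vmin = argmin f v₀ (allFin m)

  S : ℕ
  S = f vmax ∸ f vmin

  fmin≤ : ∀ v → f vmin ≤ f v
  fmin≤ v = All.lookup (f[argmin]≤f[xs] v₀ (allFin m)) (∈-allFin v)

  half : Fin m → ℕ
  half v = ⌊ f v ∸ f vmin /2⌋

  half< : ∀ v → half v < suc ⌊ S /2⌋
  half< v = s≤s (⌊n/2⌋-mono (∸-monoˡ-≤ (f vmin) (All.lookup (f[xs]≤f[argmax] v₀ (allFin m)) (∈-allFin v))))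

  shifted : ∀ {a b} → f vmin ≤ a → 2 + a ≤ b → 2 + (a ∸ f vmin) ≤ b ∸ f vmin
  shifted c≤a 2+a≤b = ≤-trans (≤-reflexive (sym (+-∸-assoc 2 c≤a))) (∸-monoˡ-≤ (f vmin) 2+a≤b)

  half-apart : ∀ {u v} → u ≢ v → K (toℕ u) → K (toℕ v) → half u ≢ half v
  half-apart {u} {v} u≢v Ku Kv eq with 2≤dist⇒ (f u) (f v) (apart u v (K-clique u v u≢v Ku Kv))
  ... | inj₁ le = <⇒≢ (⌊n/2⌋-mono (shifted (fmin≤ u) le)) eq
  ... | inj₂ le = <⇒≢ (⌊n/2⌋-mono (shifted (fmin≤ v) le)) (sym eq)

  bucket : ∀ {x} → x < m → K x → Fin (suc ⌊ S /2⌋)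
  bucket x<m _ = fromℕ< (half< (fromℕ< x<m))

  bucket-injective : ∀ {x y} (x<m : x < m) (y<m : y < m) (Kx : K x) (Ky : K y) →
    bucket x<m Kx ≡ bucket y<m Ky → x ≡ y
  bucket-injective {x} {y} x<m y<m Kx Ky eq with x ≟ y
  ... | yes x≡y = x≡y
  ... | no x≢y = contradiction
    (trans (sym (toℕ-fromℕ< (half< (fromℕ< x<m)))) (trans (cong toℕ eq) (toℕ-fromℕ< (half< (fromℕ< y<m)))))
    (half-apart (x≢y ∘ vertex≡) (subst K (sym (toℕ-fromℕ< x<m)) Kx) (subst K (sym (toℕ-fromℕ< y<m)) Ky))
    where
    vertex≡ : fromℕ< x<m ≡ fromℕ< y<m → x ≡ y
    vertex≡ e = trans (sym (toℕ-fromℕ< x<m)) (trans (cong toℕ e) (toℕ-fromℕ< y<m))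

  2c∸2≤span : 2 * count K? m ∸ 2 ≤ S
  2c∸2≤span = ≤-trans
    (m≤n+o⇒m∸n≤o (2 * count K? m) 2
      (≤-trans (*-monoʳ-≤ 2 (count≤-injection K? bucket bucket-injective)) (≤-reflexive (*-suc 2 _))))
                      (2*⌊n/2⌋≤n S)

-- The data of the labeling of Layered: Odd gets the odd labels and the rest the even ones,
-- Even first, all in the order given by weight; separated makes labels one apart legal.
record Layering {m} (G : Graph m) : Set₁ where
  field
    Odd Even         : Pred ℕ 0ℓ
    Odd?             : Decidable Odd
    Even?            : Decidable Even
    disjoint         : ∀ {x} → Odd x → ¬ Even x
    weight           : ℕ → ℕ
    weight-injective : ∀ {x y} → x < m → y < m → weight x ≡ weight y → x ≡ y
    |Odd|<|Even|     : count Odd? m < count Even? m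
    separated        : ∀ u v → Odd (toℕ u) → Even (toℕ v) →
                       rankBy Even? weight m (toℕ v) ≤ suc (rankBy Odd? weight m (toℕ u)) →
                       ¬ G u v × ¬ G v u
    ∁Odd-clique      : ∀ u v → u ≢ v → ¬ Odd (toℕ u) → ¬ Odd (toℕ v) → G u v

λ-of-layering : ∀ {m} {G : Graph m} → (∀ {u v} → G u v → u ≢ v) → 0 < m → (L : Layering G) →
  ∀ T → count (Layering.Odd? L) m + T ≡ m → LambdaIs G (2 * T ∸ 2)
λ-of-layering {m} {G} G-irreflexive 0<m L T |Odd|+T≡m =
  (labeling , labeling-isL21 , subst (SpanAtMost labeling) (cong (λ t → 2 * t ∸ 2) (sym T≡nE+nR)) labeling-span) ,
  λ f f-isL21 → subst (SpanAtLeast f) (cong (λ t → 2 * t ∸ 2) |∁Odd|≡T) (clique-span G (∁? Odd?) 0<m ∁Odd-clique f f-isL21)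
  where
  open Layering L

  R? : Decidable (∁ Odd ∩ ∁ Even)
  R? = ∁? Odd? ∩? ∁? Even?

  nE nR : ℕ
  nE = count Even? m
  nR = count R? m

  ranking : ∀ {S} (S? : Decidable S) → Ranking S m (count S? m)
  ranking S? = rankingBy S? weight m weight-injective

  open Layered G G-irreflexive Odd? Even? (ranking Odd?) (ranking Even?) (ranking R?) |Odd|<|Even| separated

  |∁Odd|≡T : count (∁? Odd?) m ≡ T
  |∁Odd|≡T = +-cancelˡ-≡ (count Odd? m) _ _ (trans (count+count-∁ Odd? m) (sym |Odd|+T≡m))

  T≡nE+nR : T ≡ nE + nR
  T≡nE+nR = begin
    T                                 ≡⟨ sym |∁Odd|≡T ⟩
    count (∁? Odd?) m                 ≡⟨ count-∩-∁ (∁? Odd?) Even? m ⟩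
    count (∁? Odd? ∩? Even?) m + nR   ≡⟨ cong (_+ nR) (count-cong _ Even? m (λ _ → proj₂) (λ _ Ex → (flip disjoint Ex) , Ex)) ⟩
    nE + nR                           ∎
    where open ≡-Reasoning

-- IsPowerOf m y x unfolds to IsMultipleMod m (toℕ y) (toℕ x).
IsMultipleMod : ℕ → ℕ → ℕ → Set
IsMultipleMod M w u = ∃[ k ] ∃[ t ] (k * u ≡ w + t * M)

multipleMod-∣ : ∀ {M w u d} → IsMultipleMod M w u → d ∣ u → d ∣ M → d ∣ w
multipleMod-∣ {M} {w} {d = d} (k , t , ku≡w+tM) d∣u d∣M =
  ∣m+n∣m⇒∣n (subst (d ∣_) (trans ku≡w+tM (+-comm w (t * M))) (∣n⇒∣m*n k d∣u)) (∣n⇒∣m*n t d∣M)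

module _ (M : ℕ) .{{_ : NonZero M}} where

  gcd-multipleMod : ∀ u → ∃[ k ] (k * u) % M ≡ gcd u M % M
  gcd-multipleMod u with Bézout.identity (gcd-GCD u M)
  ... | Bézout.+- x y g+yM≡xu = x , trans (cong (_% M) (sym g+yM≡xu)) ([m+kn]%n≡m%n _ y M)
  ... | Bézout.-+ x y g+xu≡yM = x * pred M , (begin  -- (M − 1)·x·u ≡ −x·u ≡ gcd u M (mod M)
    (x * pred M * u) % M                 ≡⟨ [m+kn]%n≡m%n _ y M ⟨
    (x * pred M * u + y * M) % M         ≡⟨ cong (λ t → (x * pred M * u + t) % M) (sym g+xu≡yM) ⟩
    (x * pred M * u + (g + x * u)) % M   ≡⟨ cong (_% M) (regroup x u g (pred M)) ⟩
    (g + x * u * suc (pred M)) % M       ≡⟨ cong (λ m → (g + x * u * m) % M) (suc-pred M) ⟩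
    (g + x * u * M) % M                  ≡⟨ [m+kn]%n≡m%n g (x * u) M ⟩
    g % M                                ∎)
    where
    open ≡-Reasoning
    g : ℕ
    g = gcd u M
    regroup : ∀ x u g m → x * m * u + (g + x * u) ≡ g + x * u * suc m
    regroup = solve-∀

  multipleMod-gcd : ∀ {u w} → w < M → gcd u M ∣ w → IsMultipleMod M w u
  multipleMod-gcd {u} {w} w<M (divides c w≡cg) with gcd-multipleMod u
  ... | k , ku≡g = c * k , (c * k * u) / M , (begin
    c * k * u                                  ≡⟨ m≡m%n+[m/n]*n (c * k * u) M ⟩
    (c * k * u) % M + (c * k * u) / M * M      ≡⟨ cong (_+ (c * k * u) / M * M) remainder ⟩
    w + (c * k * u) / M * M                    ∎)
    where
    open ≡-Reasoning
    remainder : (c * k * u) % M ≡ w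
    remainder = begin
      (c * k * u) % M                    ≡⟨ cong (_% M) (*-assoc c k u) ⟩
      (c * (k * u)) % M                  ≡⟨ %-distribˡ-* c (k * u) M ⟩
      ((c % M) * ((k * u) % M)) % M      ≡⟨ cong (λ r → ((c % M) * r) % M) ku≡g ⟩
      ((c % M) * (gcd u M % M)) % M      ≡⟨ %-distribˡ-* c (gcd u M) M ⟨
      (c * gcd u M) % M                  ≡⟨ cong (_% M) w≡cg ⟨
      w % M                              ≡⟨ m<n⇒m%n≡m w<M ⟩
      w                                  ∎

prime∤⇒coprime : ∀ {p n} → Prime p → ¬ p ∣ n → Coprime n p
prime∤⇒coprime pp p∤n (d∣n , d∣p) with prime⇒irreducible pp d∣p
... | inj₁ d≡1    = d≡1
... | inj₂ refl   = contradiction d∣n p∤n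

^-monoʳ-∣ : ∀ q {j k} → j ≤ k → q ^ j ∣ q ^ k
^-monoʳ-∣ q {j} {k} j≤k =
  divides (q ^ (k ∸ j)) (trans (cong (q ^_) (sym (m∸n+n≡m j≤k))) (^-distribˡ-+-* q (k ∸ j) j))

∣prime^⇒≡prime^ : ∀ {q} → Prime q → ∀ k {d} → d ∣ q ^ k → ∃[ a ] a ≤ k × d ≡ q ^ a
∣prime^⇒≡prime^ pq zero d∣1 = 0 , z≤n , ∣1⇒≡1 d∣1
∣prime^⇒≡prime^ {q} pq (suc k) {d} d∣q^1+k with q ∣? d
... | no q∤d with ∣prime^⇒≡prime^ pq k (coprime-divisor (prime∤⇒coprime pq q∤d) d∣q^1+k)
...   | a , a≤k , d≡q^a = a , m≤n⇒m≤1+n a≤k , d≡q^a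
∣prime^⇒≡prime^ {q} pq (suc k) {d} d∣q^1+k | yes (divides e refl)
  with ∣prime^⇒≡prime^ pq k (*-cancelˡ-∣ q {{prime⇒nonZero pq}} (subst (_∣ q ^ suc k) (*-comm e q) d∣q^1+k))
... | a , a≤k , refl = suc a , s≤s a≤k , *-comm (q ^ a) q

-- The largest e ≤ k with q ^ e ∣ x (so k itself at x = 0).
cappedValuation : ℕ → ℕ → ℕ → ℕ
cappedValuation q zero    x = zero
cappedValuation q (suc k) x with q ^ suc k ∣? x
... | yes _ = suc k
... | no  _ = cappedValuation q k x

module _ (q : ℕ) where

  cappedValuation≤ : ∀ k x → cappedValuation q k x ≤ k
  cappedValuation≤ zero x = z≤n
  cappedValuation≤ (suc k) x with q ^ suc k ∣? x
  ... | yes _ = ≤-refl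
  ... | no  _ = m≤n⇒m≤1+n (cappedValuation≤ k x)

  ^cappedValuation∣ : ∀ k x → q ^ cappedValuation q k x ∣ x
  ^cappedValuation∣ zero x = 1∣ x
  ^cappedValuation∣ (suc k) x with q ^ suc k ∣? x
  ... | yes q^1+k∣x = q^1+k∣x
  ... | no  _       = ^cappedValuation∣ k x

  ∣⇒≤cappedValuation : ∀ {e} k x → e ≤ k → q ^ e ∣ x → e ≤ cappedValuation q k x
  ∣⇒≤cappedValuation zero x e≤0 _ = e≤0
  ∣⇒≤cappedValuation (suc k) x e≤1+k q^e∣x with q ^ suc k ∣? x | m≤n⇒m<n∨m≡n e≤1+k
  ... | yes _        | _          = e≤1+k
  ... | no _         | inj₁ e<1+k = ∣⇒≤cappedValuation k x (s≤s⁻¹ e<1+k) q^e∣x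
  ... | no q^1+k∤x   | inj₂ refl  = contradiction q^e∣x q^1+k∤x

  ≤cappedValuation⇒∣ : ∀ {e} k x → e ≤ cappedValuation q k x → q ^ e ∣ x
  ≤cappedValuation⇒∣ k x e≤ν = ∣-trans (^-monoʳ-∣ q e≤ν) (^cappedValuation∣ k x)

module PQ (p q n′ : ℕ) (p-prime : Prime p) (q-prime : Prime q) (p≢q : p ≢ q) where

  n : ℕ
  n = suc n′

  M : ℕ
  M = p * q ^ n

  instance
    p≢0 : NonZero p
    p≢0 = prime⇒nonZero p-prime
    q≢0 : NonZero q
    q≢0 = prime⇒nonZero q-prime
    M≢0 : NonZero M
    M≢0 = m*n≢0 p (q ^ n) {{p≢0}} {{m^n≢0 q n}}

  0<M : 0 < M
  0<M = >-nonZero⁻¹ M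

  p∣M : p ∣ M
  p∣M = m∣m*n (q ^ n)

  q∣M : q ∣ M
  q∣M = ∣n⇒∣m*n p (m∣m*n (q ^ n′))

  q^1∣⇒q∣ : ∀ {x} → q ^ 1 ∣ x → q ∣ x
  q^1∣⇒q∣ {x} = subst (_∣ x) (*-identityʳ q)

  q∣⇒q^1∣ : ∀ {x} → q ∣ x → q ^ 1 ∣ x
  q∣⇒q^1∣ {x} = subst (_∣ x) (sym (*-identityʳ q))

  ν : ℕ → ℕ
  ν = cappedValuation q n

  ν≤n : ∀ x → ν x ≤ n
  ν≤n = cappedValuation≤ q n

  q^ν∣ : ∀ x → q ^ ν x ∣ x
  q^ν∣ = ^cappedValuation∣ q n

  q^ν∣M : ∀ x → q ^ ν x ∣ M
  q^ν∣M x = ∣-trans (^-monoʳ-∣ q (ν≤n x)) (n∣m*n p)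

  ∣⇒≤ν : ∀ {e} x → e ≤ n → q ^ e ∣ x → e ≤ ν x
  ∣⇒≤ν = ∣⇒≤cappedValuation q n

  ≤ν⇒∣ : ∀ {e} x → e ≤ ν x → q ^ e ∣ x
  ≤ν⇒∣ = ≤cappedValuation⇒∣ q n

  ¬q∣⇒ν≤ : ∀ {x y} → ¬ q ∣ x → ν x ≤ ν y
  ¬q∣⇒ν≤ {x} q∤x = ≤-trans (≮⇒≥ λ 0<νx → q∤x (q^1∣⇒q∣ (≤ν⇒∣ x 0<νx))) z≤n

  p∤q^ : ∀ j → ¬ p ∣ q ^ j
  p∤q^ zero p∣1 = nonTrivial⇒≢1 {{prime⇒nonTrivial p-prime}} (∣1⇒≡1 p∣1)
  p∤q^ (suc j) p∣q^1+j with euclidsLemma q (q ^ j) p-prime p∣q^1+j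
  ... | inj₂ p∣q^j = p∤q^ j p∣q^j
  ... | inj₁ p∣q with prime⇒irreducible q-prime p∣q
  ...   | inj₁ p≡1 = nonTrivial⇒≢1 {{prime⇒nonTrivial p-prime}} p≡1
  ...   | inj₂ p≡q = p≢q p≡q

  p∣∧q^j∣⇒p*q^j∣ : ∀ j {x} → p ∣ x → q ^ j ∣ x → p * q ^ j ∣ x
  p∣∧q^j∣⇒p*q^j∣ j p∣x (divides c refl) = *-monoˡ-∣ (q ^ j)
    (coprime-divisor (Coprime.sym (prime∤⇒coprime p-prime (p∤q^ j))) (subst (p ∣_) (*-comm c (q ^ j)) p∣x))

  ∣q^n⇒∣q^ν : ∀ {d x} → d ∣ q ^ n → d ∣ x → d ∣ q ^ ν x
  ∣q^n⇒∣q^ν {x = x} d∣q^n d∣x with ∣prime^⇒≡prime^ q-prime n d∣q^n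
  ... | a , a≤n , refl = ^-monoʳ-∣ q (∣⇒≤ν x a≤n d∣x)

  gcd∣q^ν : ∀ {x} → ¬ p ∣ gcd x M → gcd x M ∣ q ^ ν x
  gcd∣q^ν {x} p∤g = ∣q^n⇒∣q^ν (coprime-divisor (prime∤⇒coprime p-prime p∤g) (gcd[m,n]∣n x M)) (gcd[m,n]∣m x M)

  gcd∣p*q^ν : ∀ x → gcd x M ∣ p * q ^ ν x
  gcd∣p*q^ν x with p ∣? gcd x M
  ... | no p∤g = ∣n⇒∣m*n p (gcd∣q^ν p∤g)
  ... | yes (divides g′ g≡g′p) = subst (_∣ p * q ^ ν x) (trans (*-comm p g′) (sym g≡g′p))
        (*-monoʳ-∣ p (∣q^n⇒∣q^ν (*-cancelˡ-∣ p pg′∣p*q^n) (∣-trans (m∣m*n p) g′p∣x)))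
    where
    pg′∣p*q^n : p * g′ ∣ p * q ^ n
    pg′∣p*q^n = subst (_∣ M) (trans g≡g′p (*-comm g′ p)) (gcd[m,n]∣n x M)
    g′p∣x : g′ * p ∣ x
    g′p∣x = subst (_∣ x) g≡g′p (gcd[m,n]∣m x M)

  gcd∣-if-p∤ : ∀ {x y} → ¬ p ∣ x → ν x ≤ ν y → gcd x M ∣ y
  gcd∣-if-p∤ {x} {y} p∤x νx≤νy = ∣-trans (gcd∣q^ν (p∤x ∘ flip ∣-trans (gcd[m,n]∣m x M))) (≤ν⇒∣ y νx≤νy)

  gcd∣-if-p∣ : ∀ {x y} → p ∣ y → ν x ≤ ν y → gcd x M ∣ y
  gcd∣-if-p∣ {x} {y} p∣y νx≤νy = ∣-trans (gcd∣p*q^ν x) (p∣∧q^j∣⇒p*q^j∣ (ν x) p∣y (≤ν⇒∣ y νx≤νy))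

  adjacent-if-gcd∣ : ∀ {u w : Fin M} → u ≢ w → gcd (toℕ u) M ∣ toℕ w ⊎ gcd (toℕ w) M ∣ toℕ u → PowAdj M u w
  adjacent-if-gcd∣ u≢w (inj₁ gcd[u]∣w) = u≢w , inj₂ (multipleMod-gcd M (toℕ<n _) gcd[u]∣w)
  adjacent-if-gcd∣ u≢w (inj₂ gcd[w]∣u) = u≢w , inj₁ (multipleMod-gcd M (toℕ<n _) gcd[w]∣u)

  unrelated : ∀ {u v : Fin M} → ¬ IsMultipleMod M (toℕ v) (toℕ u) → ¬ IsMultipleMod M (toℕ u) (toℕ v) →
    ¬ PowAdj M u v × ¬ PowAdj M v u
  unrelated v∉⟨u⟩ u∉⟨v⟩ = [ u∉⟨v⟩ , v∉⟨u⟩ ]′ ∘ proj₂ , [ v∉⟨u⟩ , u∉⟨v⟩ ]′ ∘ proj₂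

  q^n≡q^j*q^[n∸j] : ∀ {j} → j ≤ n → q ^ n ≡ q ^ j * q ^ (n ∸ j)
  q^n≡q^j*q^[n∸j] {j} j≤n = trans (cong (q ^_) (sym (m+[n∸m]≡n j≤n))) (^-distribˡ-+-* q j (n ∸ j))

  count-∣M : ∀ d c → d * c ≡ M → count (d ∣?_) M ≡ c
  count-∣M d c dc≡M = trans (cong (count (d ∣?_)) (trans (sym dc≡M) (*-comm d c))) (count-multiples d c {{d≢0}})
    where
    d≢0 : NonZero d
    d≢0 = m*n≢0⇒m≢0 d {{subst NonZero (sym dc≡M) M≢0}}

  |p*q^j∣| : ∀ {j} → j ≤ n → count ((p * q ^ j) ∣?_) M ≡ q ^ (n ∸ j)
  |p*q^j∣| {j} j≤n = count-∣M (p * q ^ j) (q ^ (n ∸ j)) (trans (*-assoc p _ _) (cong (p *_) (sym (q^n≡q^j*q^[n∸j] j≤n))))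

  |q^j∣| : ∀ {j} → j ≤ n → count ((q ^ j) ∣?_) M ≡ p * q ^ (n ∸ j)
  |q^j∣| {j} j≤n = count-∣M (q ^ j) (p * q ^ (n ∸ j)) (begin
    q ^ j * (p * q ^ (n ∸ j))  ≡⟨ x∙yz≈y∙xz (q ^ j) p _ ⟩
    p * (q ^ j * q ^ (n ∸ j))  ≡⟨ cong (p *_) (q^n≡q^j*q^[n∸j] j≤n) ⟨
    M                          ∎)
    where open ≡-Reasoning

  |p∣∩q^j∣| : ∀ {j} → j ≤ n → count ((p ∣?_) ∩? (q ^ j ∣?_)) M ≡ q ^ (n ∸ j)
  |p∣∩q^j∣| {j} j≤n = trans
    (count-cong _ _ M (λ _ (p∣x , q^j∣x) → p∣∧q^j∣⇒p*q^j∣ j p∣x q^j∣x)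
                      (λ _ pq^j∣x → m*n∣⇒m∣ p (q ^ j) pq^j∣x , m*n∣⇒n∣ p (q ^ j) pq^j∣x))
    (|p*q^j∣| j≤n)

  |q^j∣∩∁p∣| : ∀ {j} → j ≤ n → q ^ (n ∸ j) + count ((q ^ j ∣?_) ∩? ∁? (p ∣?_)) M ≡ p * q ^ (n ∸ j)
  |q^j∣∩∁p∣| {j} j≤n = begin
    q ^ (n ∸ j) + c                           ≡⟨ cong (_+ c) (trans (sym (|p∣∩q^j∣| j≤n)) (count-cong _ _ M (const swap) (const swap))) ⟩
    count ((q ^ j ∣?_) ∩? (p ∣?_)) M + c      ≡⟨ count-∩-∁ (q ^ j ∣?_) (p ∣?_) M ⟨
    count ((q ^ j) ∣?_) M                     ≡⟨ |q^j∣| j≤n ⟩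
    p * q ^ (n ∸ j)                           ∎
    where
    open ≡-Reasoning
    c : ℕ
    c = count ((q ^ j ∣?_) ∩? ∁? (p ∣?_)) M

  |p*q^j∣∩∁0| : ∀ {j} → j ≤ n → 1 + count ((p * q ^ j ∣?_) ∩? ∁? (_≟ 0)) M ≡ q ^ (n ∸ j)
  |p*q^j∣∩∁0| {j} j≤n = begin
    1 + c                                     ≡⟨ cong (_+ c) (sym |zero|) ⟩
    count ((p * q ^ j ∣?_) ∩? (_≟ 0)) M + c   ≡⟨ count-∩-∁ (p * q ^ j ∣?_) (_≟ 0) M ⟨
    count ((p * q ^ j) ∣?_) M                 ≡⟨ |p*q^j∣| j≤n ⟩
    q ^ (n ∸ j)                               ∎
    where
    open ≡-Reasoning
    c : ℕ
    c = count ((p * q ^ j ∣?_) ∩? ∁? (_≟ 0)) M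
    |zero| : count ((p * q ^ j ∣?_) ∩? (_≟ 0)) M ≡ 1
    |zero| = trans (count-cong _ (_≟ 0) M (λ _ → proj₂) (λ { _ refl → (_ ∣0) , refl }))
                   (trans (cong (count (_≟ 0)) (sym (suc-pred M))) (count-≡0 (pred M)))

  p∣∧q∤ q∣∧p∤ p∣∧≢0 : Pred ℕ 0ℓ
  p∣∧q∤ = (p ∣_) ∩ ∁ (q ∣_)
  q∣∧p∤ = (q ∣_) ∩ ∁ (p ∣_)
  p∣∧≢0 = (p ∣_) ∩ ∁ (_≡ 0)

  p∣∧q∤? : Decidable p∣∧q∤
  p∣∧q∤? = (p ∣?_) ∩? ∁? (q ∣?_)

  q∣∧p∤? : Decidable q∣∧p∤
  q∣∧p∤? = (q ∣?_) ∩? ∁? (p ∣?_)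

  p∣∧≢0? : Decidable p∣∧≢0
  p∣∧≢0? = (p ∣?_) ∩? ∁? (_≟ 0)

  |q∣∧p∤| : q ^ n′ + count q∣∧p∤? M ≡ p * q ^ n′
  |q∣∧p∤| = trans
    (cong (q ^ n′ +_) (count-cong _ _ M (λ _ (q∣x , p∤x) → q∣⇒q^1∣ q∣x , p∤x)
                                        (λ _ (q^1∣x , p∤x) → q^1∣⇒q∣ q^1∣x , p∤x)))
    (|q^j∣∩∁p∣| (s≤s z≤n))

  |p∣∧q∤| : q ^ n′ + count p∣∧q∤? M ≡ q ^ n
  |p∣∧q∤| = begin
    q ^ n′ + count p∣∧q∤? M                         ≡⟨ cong (_+ count p∣∧q∤? M) (sym |p∣∧q∣|) ⟩
    count ((p ∣?_) ∩? (q ∣?_)) M + count p∣∧q∤? M   ≡⟨ count-∩-∁ (p ∣?_) (q ∣?_) M ⟨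
    count (p ∣?_) M                                 ≡⟨ count-∣M p (q ^ n) refl ⟩
    q ^ n                                           ∎
    where
    open ≡-Reasoning
    |p∣∧q∣| : count ((p ∣?_) ∩? (q ∣?_)) M ≡ q ^ n′
    |p∣∧q∣| = trans (count-cong _ _ M (λ _ (p∣x , q∣x) → p∣x , q∣⇒q^1∣ q∣x)
                                      (λ _ (p∣x , q^1∣x) → p∣x , q^1∣⇒q∣ q^1∣x))
                    (|p∣∩q^j∣| (s≤s z≤n))

  |p∣∧≢0| : 1 + count p∣∧≢0? M ≡ q ^ n
  |p∣∧≢0| = trans
    (cong suc (count-cong _ _ M (λ _ (p∣x , x≢0) → subst (_∣ _) (sym (*-identityʳ p)) p∣x , x≢0)
                                (λ _ (p∣x , x≢0) → subst (_∣ _) (*-identityʳ p) p∣x , x≢0)))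
    (|p*q^j∣∩∁0| z≤n)

  λ-when-p<q : p < q → LambdaIs (PowAdj M) (2 * q ^ n′ * (p * q ∸ p + 1) ∸ 2)
  λ-when-p<q p<q = subst (LambdaIs (PowAdj M)) (cong (_∸ 2) (sym (*-assoc 2 (q ^ n′) _)))
    (λ-of-layering proj₁ 0<M layering (q ^ n′ * (p * q ∸ p + 1)) |Odd|+T≡M)
    where
    clique : ∀ u w → u ≢ w → ¬ q∣∧p∤ (toℕ u) → ¬ q∣∧p∤ (toℕ w) → PowAdj M u w
    clique u w u≢w ¬q∣∧p∤u ¬q∣∧p∤w with p ∣? toℕ u | p ∣? toℕ w
    ... | no p∤u | _ = adjacent-if-gcd∣ u≢w (inj₁ (gcd∣-if-p∤ p∤u (¬q∣⇒ν≤ λ q∣u → ¬q∣∧p∤u (q∣u , p∤u))))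
    ... | yes _ | no p∤w = adjacent-if-gcd∣ u≢w (inj₂ (gcd∣-if-p∤ p∤w (¬q∣⇒ν≤ λ q∣w → ¬q∣∧p∤w (q∣w , p∤w))))
    ... | yes p∣u | yes p∣w with ≤-total (ν (toℕ u)) (ν (toℕ w))
    ...   | inj₁ νu≤νw = adjacent-if-gcd∣ u≢w (inj₁ (gcd∣-if-p∣ p∣w νu≤νw))
    ...   | inj₂ νw≤νu = adjacent-if-gcd∣ u≢w (inj₂ (gcd∣-if-p∣ p∣u νw≤νu))

    layering : Layering (PowAdj M)
    layering = record
      { Odd = q∣∧p∤ ; Even = p∣∧q∤ ; Odd? = q∣∧p∤? ; Even? = p∣∧q∤?
      ; disjoint = λ (_ , p∤x) (p∣x , _) → p∤x p∣x
      ; weight = id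
      ; weight-injective = λ _ _ eq → eq
      ; |Odd|<|Even| = +-cancelˡ-< (q ^ n′) _ _
          (subst₂ _<_ (sym |q∣∧p∤|) (sym |p∣∧q∤|) (*-monoˡ-< (q ^ n′) {{m^n≢0 q n′}} p<q))
      ; separated = λ u v (q∣u , p∤u) (p∣v , q∤v) _ → unrelated
          (λ v∈⟨u⟩ → q∤v (multipleMod-∣ v∈⟨u⟩ q∣u q∣M)) (λ u∈⟨v⟩ → p∤u (multipleMod-∣ u∈⟨v⟩ p∣v p∣M))
      ; ∁Odd-clique = clique
      }

    |Odd|+T≡M : count q∣∧p∤? M + q ^ n′ * (p * q ∸ p + 1) ≡ M
    |Odd|+T≡M = begin
      count q∣∧p∤? M + q ^ n′ * (p * q ∸ p + 1)        ≡⟨ regroup (count q∣∧p∤? M) (q ^ n′) (p * q ∸ p) ⟩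
      (q ^ n′ + count q∣∧p∤? M) + q ^ n′ * (p * q ∸ p) ≡⟨ cong (_+ q ^ n′ * (p * q ∸ p)) |q∣∧p∤| ⟩
      p * q ^ n′ + q ^ n′ * (p * q ∸ p)                ≡⟨ factor p (q ^ n′) (p * q ∸ p) ⟩
      q ^ n′ * (p * q ∸ p + p)                         ≡⟨ cong (q ^ n′ *_) (m∸n+n≡m (m≤m*n p q)) ⟩
      q ^ n′ * (p * q)                                 ≡⟨ reorder (q ^ n′) p q ⟩
      M                                                ∎
      where
      open ≡-Reasoning
      regroup : ∀ c x d → c + x * (d + 1) ≡ (x + c) + x * d
      regroup = solve-∀
      factor : ∀ p x d → p * x + x * d ≡ x * (d + p)
      factor = solve-∀
      reorder : ∀ x p q → x * (p * q) ≡ p * (q * x)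
      reorder = solve-∀

  -- Lists vertices by decreasing ν, ties broken by the vertex itself.
  weight : ℕ → ℕ
  weight x = x + (n ∸ ν x) * M

  weight-injective : ∀ {x y} → x < M → y < M → weight x ≡ weight y → x ≡ y
  weight-injective {x} {y} x<M y<M eq = begin
    x                ≡⟨ m<n⇒m%n≡m x<M ⟨
    x % M            ≡⟨ [m+kn]%n≡m%n x (n ∸ ν x) M ⟨
    weight x % M     ≡⟨ cong (_% M) eq ⟩
    weight y % M     ≡⟨ [m+kn]%n≡m%n y (n ∸ ν y) M ⟩
    y % M            ≡⟨ m<n⇒m%n≡m y<M ⟩
    y                ∎
    where open ≡-Reasoning

  weight-< : ∀ {x y} → y < M → ν x < ν y → weight y < weight x
  weight-< {x} {y} y<M νx<νy = begin-strict
    y + (n ∸ ν y) * M          <⟨ +-monoˡ-< _ y<M ⟩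
    suc (n ∸ ν y) * M          ≤⟨ *-monoˡ-≤ M (∸-monoʳ-< νx<νy (ν≤n y)) ⟩
    (n ∸ ν x) * M              ≤⟨ m≤n+m _ x ⟩
    x + (n ∸ ν x) * M          ∎
    where open ≤-Reasoning

  -- The p∣∧≢0 elements preceding u are multiples of p q^ν(u), while every q∣∧p∤ element of
  -- valuation above ν(u) precedes v; as q < p the latter outnumber the former by at least two.
  rank-gap : ∀ {u v} → u < M → p∣∧≢0 u → q∣∧p∤ v → q < p → ν v ≤ ν u →
    2 + rankBy p∣∧≢0? weight M u ≤ rankBy q∣∧p∤? weight M v
  rank-gap {u} {v} u<M (p∣u , u≢0) _ q<p νv≤νu = begin
    2 + rankBy p∣∧≢0? weight M u                    ≤⟨ s≤s below ⟩
    1 + count ((p * q ^ a ∣?_) ∩? ∁? (_≟ 0)) M       ≡⟨ |p*q^j∣∩∁0| (<⇒≤ a<n) ⟩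
    q ^ (n ∸ a)                                      ≡⟨ cong (q ^_) (+-∸-assoc 1 (s≤s⁻¹ a<n)) ⟩
    q * y                                            ≤⟨ +-cancelˡ-≤ y _ _ (begin
      y + q * y                                          ≤⟨ *-monoˡ-≤ y q<p ⟩
      p * y                                              ≡⟨ |q^j∣∩∁p∣| a<n ⟨
      y + count ((q ^ suc a ∣?_) ∩? ∁? (p ∣?_)) M        ∎) ⟩
    count ((q ^ suc a ∣?_) ∩? ∁? (p ∣?_)) M          ≤⟨ above ⟩
    rankBy q∣∧p∤? weight M v                          ∎
    where
    open ≤-Reasoning
    a y : ℕ
    a = ν u
    y = q ^ (n′ ∸ a)

    a<n : a < n
    a<n = ≤∧≢⇒< (ν≤n u) λ a≡n →
      <⇒≱ u<M (∣⇒≤ {{≢-nonZero u≢0}} (p∣∧q^j∣⇒p*q^j∣ n p∣u (subst (λ e → q ^ e ∣ u) a≡n (q^ν∣ u))))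

    below : rankBy p∣∧≢0? weight M u < count ((p * q ^ a ∣?_) ∩? ∁? (_≟ 0)) M
    below = count-mono-< _ _ M
      (λ {z} _ ((p∣z , z≢0) , wz<wu) →
        p∣∧q^j∣⇒p*q^j∣ a p∣z (≤ν⇒∣ z (≮⇒≥ λ νz<νu → <-asym wz<wu (weight-< u<M νz<νu))) , z≢0)
      u<M (p∣∧q^j∣⇒p*q^j∣ a p∣u (q^ν∣ u) , u≢0) (<-irrefl refl ∘ proj₂)

    above : count ((q ^ suc a ∣?_) ∩? ∁? (p ∣?_)) M ≤ rankBy q∣∧p∤? weight M v
    above = count-mono _ _ M λ {z} z<M (q^1+a∣z , p∤z) →
      (∣-trans (m∣m*n (q ^ a)) q^1+a∣z , p∤z) , weight-< z<M (≤-<-trans νv≤νu (∣⇒≤ν z a<n q^1+a∣z))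

  λ-when-q<p : q < p → LambdaIs (PowAdj M) (2 * q ^ n * (p ∸ 1))
  λ-when-q<p q<p = subst (LambdaIs (PowAdj M)) (2*[x+1]∸2 (q ^ n) (p ∸ 1))
    (λ-of-layering proj₁ 0<M layering (q ^ n * (p ∸ 1) + 1) |Odd|+T≡M)
    where
    separated : ∀ u v → p∣∧≢0 (toℕ u) → q∣∧p∤ (toℕ v) →
      rankBy q∣∧p∤? weight M (toℕ v) ≤ suc (rankBy p∣∧≢0? weight M (toℕ u)) → ¬ PowAdj M u v × ¬ PowAdj M v u
    separated u v p∣∧≢0u@(p∣u , _) q∣∧p∤v@(_ , p∤v) rank≤ = unrelated
      (λ v∈⟨u⟩ → p∤v (multipleMod-∣ v∈⟨u⟩ p∣u p∣M))
      (λ u∈⟨v⟩ → <⇒≱ νu<νv (∣⇒≤ν (toℕ u) (ν≤n (toℕ v)) (multipleMod-∣ u∈⟨v⟩ (q^ν∣ (toℕ v)) (q^ν∣M (toℕ v)))))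
      where
      νu<νv : ν (toℕ u) < ν (toℕ v)
      νu<νv = ≰⇒> λ νv≤νu → 1+n≰n (≤-trans (rank-gap (toℕ<n u) p∣∧≢0u q∣∧p∤v q<p νv≤νu) rank≤)

    clique : ∀ u w → u ≢ w → ¬ p∣∧≢0 (toℕ u) → ¬ p∣∧≢0 (toℕ w) → PowAdj M u w
    clique u w u≢w ¬p∣∧≢0u ¬p∣∧≢0w with toℕ u ≟ 0 | toℕ w ≟ 0
    ... | yes u≡0 | _ = adjacent-if-gcd∣ u≢w (inj₂ (subst (_ ∣_) (sym u≡0) (_ ∣0)))
    ... | no _ | yes w≡0 = adjacent-if-gcd∣ u≢w (inj₁ (subst (_ ∣_) (sym w≡0) (_ ∣0)))
    ... | no u≢0 | no w≢0 with ≤-total (ν (toℕ u)) (ν (toℕ w))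
    ...   | inj₁ νu≤νw = adjacent-if-gcd∣ u≢w (inj₁ (gcd∣-if-p∤ (λ p∣u → ¬p∣∧≢0u (p∣u , u≢0)) νu≤νw))
    ...   | inj₂ νw≤νu = adjacent-if-gcd∣ u≢w (inj₂ (gcd∣-if-p∤ (λ p∣w → ¬p∣∧≢0w (p∣w , w≢0)) νw≤νu))

    layering : Layering (PowAdj M)
    layering = record
      { Odd = p∣∧≢0 ; Even = q∣∧p∤ ; Odd? = p∣∧≢0? ; Even? = q∣∧p∤?
      ; disjoint = λ (p∣x , _) (_ , p∤x) → p∤x p∣x
      ; weight = weight
      ; weight-injective = weight-injective
      ; |Odd|<|Even| = +-cancelˡ-≤ (q ^ n′) _ _ (begin
          q ^ n′ + suc (count p∣∧≢0? M)   ≡⟨ cong (q ^ n′ +_) |p∣∧≢0| ⟩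
          q ^ n′ + q ^ n                  ≤⟨ *-monoˡ-≤ (q ^ n′) q<p ⟩
          p * q ^ n′                      ≡⟨ |q∣∧p∤| ⟨
          q ^ n′ + count q∣∧p∤? M         ∎)
      ; separated = separated
      ; ∁Odd-clique = clique
      }
      where open ≤-Reasoning

    |Odd|+T≡M : count p∣∧≢0? M + (q ^ n * (p ∸ 1) + 1) ≡ M
    |Odd|+T≡M = begin
      count p∣∧≢0? M + (q ^ n * (p ∸ 1) + 1)    ≡⟨ regroup (count p∣∧≢0? M) (q ^ n) (p ∸ 1) ⟩
      (1 + count p∣∧≢0? M) + q ^ n * (p ∸ 1)    ≡⟨ cong (_+ q ^ n * (p ∸ 1)) |p∣∧≢0| ⟩
      q ^ n + q ^ n * (p ∸ 1)                   ≡⟨ *-suc (q ^ n) (p ∸ 1) ⟨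
      q ^ n * suc (p ∸ 1)                       ≡⟨ cong (q ^ n *_) (suc-pred p) ⟩
      q ^ n * p                                 ≡⟨ *-comm (q ^ n) p ⟩
      M                                         ∎
      where
      open ≡-Reasoning
      regroup : ∀ c x d → c + (x * d + 1) ≡ (1 + c) + x * d
      regroup = solve-∀

    2*[x+1]∸2 : ∀ x d → 2 * (x * d + 1) ∸ 2 ≡ 2 * x * d
    2*[x+1]∸2 x d = trans (cong (_∸ 2) (*-distribˡ-+ 2 (x * d) 1)) (trans (m+n∸n≡m (2 * (x * d)) 2) (sym (*-assoc 2 x d)))

lemma4p2 : (p q n : ℕ) → Prime p → Prime q → p ≢ q → 1 ≤ n →
    (p < q → LambdaIs (PowAdj (p * q ^ n)) (2 * q ^ (n ∸ 1) * (p * q ∸ p + 1) ∸ 2)) ×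
    (q < p → LambdaIs (PowAdj (p * q ^ n)) (2 * q ^ n * (p ∸ 1)))
lemma4p2 p q (suc n′) p-prime q-prime p≢q _ = λ-when-p<q , λ-when-q<p
  where open PQ p q n′ p-prime q-prime p≢q
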